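{- Let $f(x)=x^r g(x)$ where $r\ge1$ and $g(x)\in\mathbb{Z}[x]$ is nonconstant with $g(0)\neq0$. Let $x_0\in\mathbb{Z}$ have a wandering orbit $(x_n)_{n\ge0}$ under $x\mapsto f(x)$, and define \[ a_{n+1}=\frac{g(x_n)}{\gcd(g(x_n),g(0))}\quad\text{for all } n\ge0. \] Then $(a_n)_{n\ge1}$ is an infinite sequence of pairwise coprime integers, and for all sufficiently large $n$, $a_n$ has a private prime factor.
   Context: $f^n$ denotes the $n$-fold composition of $f$; the orbit of $x_0$ is $x_n=f^n(x_0)$. The orbit is wandering if the $x_n$, $n\ge0$, are pairwise distinct. For a sequence of integers $(a_n)$, a prime $p$ is a private prime factor of $a_n$ if $p$ divides $a_n$ and no other term $a_m$, $m\ne n$. -}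

module Defs where

open import Data.Nat using (ℕ; zero; suc)
open import Data.Integer using (ℤ; +_; _+_; _*_; _^_; ∣_∣)
open import Data.Integer.DivMod using (_/ℕ_)
open import Data.Integer.GCD using (gcd)
open import Data.List using (List; []; _∷_)

-- Integer polynomials as coefficient lists, lowest degree first:
-- c₀ ∷ c₁ ∷ … represents c₀ + c₁ x + …
Poly : Set
Poly = List ℤ

coeff : Poly → ℕ → ℤ
coeff []       _       = + 0
coeff (c ∷ cs) zero    = c
coeff (c ∷ cs) (suc i) = coeff cs i

eval : Poly → ℤ → ℤ
eval []       x = + 0
eval (c ∷ cs) x = c + x * eval cs x

iter : {A : Set} → (A → A) → ℕ → A → A
iter f zero    x = x
iter f (suc n) x = f (iter f n x)

fmap : ℕ → Poly → ℤ → ℤ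
fmap r g x = (x ^ r) * eval g x

-- integer divided by a natural number (only used with nonzero divisor,
-- and exact divisions; value at divisor 0 is irrelevant)
divNat : ℤ → ℕ → ℤ
divNat x zero    = + 0
divNat x (suc k) = x /ℕ suc k

-- the sequence a_{n+1} = g(x_n) / gcd(g(x_n), g(0)); a_0 is unused (set to 0)
aSeq : ℕ → Poly → ℤ → ℕ → ℤ
aSeq r g x₀ zero    = + 0
aSeq r g x₀ (suc n) =
  let y = eval g (iter (fmap r g) n x₀) in
  divNat y ∣ gcd y (eval g (+ 0)) ∣

module Submission where

-- Write C = g(0) ≠ 0 and g(x) = C + x h(x).  Since x_{m+1} = x_m^r g(x_m), both x_m and g(x_m) divide
--    x_{m+1} ∣ x_n for m < n; hence g(x_n) = C + T with g(x_m) ∣ T.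
--    Whenever B = C + T and A ∣ T, the reduced values A / gcd(A, C) and
--    B / gcd(B, C) are coprime (lemma reduce-coprime).
--  * Growth.  For any map with y ∣ f(y), a wandering orbit has |x_n|
--    nondecreasing and strictly increasing over every two steps, so |x_n| is
--    eventually larger than any bound (module Orbit).
--  * Size.  If |y| exceeds 2|C| + ‖h‖₁ then |g(y)| > |C| (lemma
--    value-exceeds-constant), and then the reduced value has absolute value at
--    least 2 (lemma reduce-large), so it has a prime factor; by pairwise
--    coprimality that prime divides no other term (lemma private-prime-factor).

open import Defs
open import Data.Nat using (ℕ; zero; suc; _≤_; _≥_)
open import Data.Nat.Primality using (Prime)
open import Data.Integer using (ℤ; +_)
open import Data.Integer.Divisibility using (_∣_)
open import Data.Integer.Coprimality using (Coprime)
open import Data.Product using (∃; _×_; _,_)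
open import Relation.Binary.PropositionalEquality using (_≡_; _≢_)
open import Relation.Nullary using (¬_)

import Data.Nat as N
import Data.Nat.Properties as NP
import Data.Nat.Divisibility as ND
import Data.Nat.DivMod as NDM
import Data.Nat.GCD as NG
import Data.Nat.Primality as NPr
import Data.Nat.Primality.Factorisation as NF
import Data.Integer as Z
import Data.Integer.Properties as ZP
import Data.Integer.Divisibility.Signed as ZS
import Data.Integer.Coprimality as ZC
open import Data.List using ([]; _∷_)
open import Data.Nat.ListAction using (product)
open import Data.List.Relation.Unary.All using (_∷_)
open import Data.Sum using (inj₁; inj₂)
open import Data.Empty using (⊥-elim)
open import Relation.Nullary using (yes; no)
open import Relation.Binary.PropositionalEquality using (refl; sym; trans; cong; subst)
open import Relation.Binary.Definitions using (tri<; tri≈; tri>)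

prime-factor : ∀ n → 2 N.≤ n → ∃ λ p → Prime p × p ND.∣ n
prime-factor (suc zero) (N.s≤s ())
prime-factor n@(suc (suc _)) _ with NF.factorise n
... | record { factors = [] ; isFactorisation = () }
... | record { factors = p ∷ ps ; isFactorisation = eq ; factorsPrime = p-prime ∷ _ } =
  p , p-prime , subst (p ND.∣_) (sym eq) (ND.m∣m*n (product ps))

sameAbs⇒neg : ∀ i j → Z.∣ i ∣ ≡ Z.∣ j ∣ → i ≢ j → i ≡ Z.- j
sameAbs⇒neg (+ m)      (+ n)      refl i≢j = ⊥-elim (i≢j refl)
sameAbs⇒neg (+ m)      Z.-[1+ n ] refl _   = refl
sameAbs⇒neg Z.-[1+ m ] (+ n)      refl _   = refl
sameAbs⇒neg Z.-[1+ m ] Z.-[1+ n ] refl i≢j = ⊥-elim (i≢j refl)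

summand-bound : ∀ c t → Z.∣ t ∣ N.≤ Z.∣ c Z.+ t ∣ N.+ Z.∣ c ∣
summand-bound c t = begin
  Z.∣ t ∣                               ≡⟨ cong Z.∣_∣ cancel ⟨
  Z.∣ Z.- c Z.+ (c Z.+ t) ∣             ≤⟨ ZP.∣i+j∣≤∣i∣+∣j∣ (Z.- c) (c Z.+ t) ⟩
  Z.∣ Z.- c ∣ N.+ Z.∣ c Z.+ t ∣         ≡⟨ cong (N._+ Z.∣ c Z.+ t ∣) (ZP.∣-i∣≡∣i∣ c) ⟩
  Z.∣ c ∣ N.+ Z.∣ c Z.+ t ∣             ≡⟨ NP.+-comm Z.∣ c ∣ Z.∣ c Z.+ t ∣ ⟩
  Z.∣ c Z.+ t ∣ N.+ Z.∣ c ∣             ∎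
  where
  open NP.≤-Reasoning
  cancel : Z.- c Z.+ (c Z.+ t) ≡ t
  cancel = trans (sym (ZP.+-assoc (Z.- c) c t))
             (trans (cong (Z._+ t) (ZP.+-inverseˡ c)) (ZP.+-identityˡ t))

divNat-exact : ∀ y d → d ≢ 0 → d ND.∣ Z.∣ y ∣ → Z.∣ divNat y d ∣ N.* d ≡ Z.∣ y ∣
divNat-exact y          zero    d≢0 _ = ⊥-elim (d≢0 refl)
divNat-exact (+ n)      (suc k) _   d∣y = NDM.m/n*n≡m d∣y
divNat-exact Z.-[1+ n ] (suc k) _   d∣y with suc n N.% suc k in rem
... | zero  = trans (cong (N._* suc k) (ZP.∣-i∣≡∣i∣ (+ (suc n N./ suc k)))) (NDM.m/n*n≡m d∣y)
... | suc _ = ⊥-elim (NP.1+n≢0 (trans (sym rem) (ND.n∣m⇒m%n≡0 (suc n) (suc k) d∣y)))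

gcdAbs : ℤ → ℤ → ℕ
gcdAbs y c = NG.gcd Z.∣ y ∣ Z.∣ c ∣

-- The reduced value y / gcd(y, c), so that a_{n+1} = reduce (g(x_n)) (g(0)).
reduce : ℤ → ℤ → ℤ
reduce y c = divNat y (gcdAbs y c)

gcdAbs-nonzero : ∀ y c → c ≢ + 0 → gcdAbs y c ≢ 0
gcdAbs-nonzero y c c≢0 gcd≡0 = c≢0 (ZP.∣i∣≡0⇒i≡0 (NG.gcd[m,n]≡0⇒n≡0 Z.∣ y ∣ gcd≡0))

reduce-exact : ∀ y c → c ≢ + 0 → Z.∣ reduce y c ∣ N.* gcdAbs y c ≡ Z.∣ y ∣
reduce-exact y c c≢0 =
  divNat-exact y (gcdAbs y c) (gcdAbs-nonzero y c c≢0) (NG.gcd[m,n]∣m Z.∣ y ∣ Z.∣ c ∣)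

-- If |y| > |c|, the reduced value is neither 0 nor ±1: otherwise
-- |y| would be 0, or would equal gcd(y, c) and so divide c.
reduce-large : ∀ y c → c ≢ + 0 → Z.∣ c ∣ N.< Z.∣ y ∣ → 2 N.≤ Z.∣ reduce y c ∣
reduce-large y c c≢0 c<y with Z.∣ reduce y c ∣ | reduce-exact y c c≢0
... | zero        | 0≡y = ⊥-elim (NP.<⇒≱ c<y (subst (N._≤ Z.∣ c ∣) 0≡y N.z≤n))
... | suc zero    | d≡y = ⊥-elim (NP.<⇒≱ c<y (ND.∣⇒≤ ⦃ c-nonZero ⦄ y∣c))
  where
  c-nonZero : N.NonZero Z.∣ c ∣
  c-nonZero = N.≢-nonZero (λ eq → c≢0 (ZP.∣i∣≡0⇒i≡0 eq))
  y∣c : Z.∣ y ∣ ND.∣ Z.∣ c ∣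
  y∣c = subst (ND._∣ Z.∣ c ∣) (trans (sym (NP.*-identityˡ _)) d≡y) (NG.gcd[m,n]∣n Z.∣ y ∣ Z.∣ c ∣)
... | suc (suc _) | _   = N.s≤s (N.s≤s N.z≤n)

unit-multiple : ∀ δ d → d ≢ 0 → δ N.* d ND.∣ d → δ ≡ 1
unit-multiple δ d d≢0 δd∣d =
  ND.∣1⇒≡1 (ND.*-cancelʳ-∣ d ⦃ N.≢-nonZero d≢0 ⦄ (subst (δ N.* d ND.∣_) (sym (NP.*-identityˡ d)) δd∣d))

-- A common divisor δ gives δ·gcd(A, c) ∣ A, B,
-- hence δ·gcd(A, c) ∣ B − T = c, hence δ·gcd(A, c) ∣ gcd(A, c).
reduce-coprime : ∀ {A B c T} → c ≢ + 0 → A ZS.∣ T → B ≡ c Z.+ T →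
  Coprime (reduce A c) (reduce B c)
reduce-coprime {A} {B} {c} {T} c≢0 A∣T B≡c+T {δ} (δ∣A' , δ∣B') =
  unit-multiple δ d (gcdAbs-nonzero A c c≢0) (NG.gcd-greatest δd∣A δd∣c)
  where
  d e : ℕ
  d = gcdAbs A c
  e = gcdAbs B c
  d∣c : + d ZS.∣ c
  d∣c = ZS.∣ᵤ⇒∣ (NG.gcd[m,n]∣n Z.∣ A ∣ Z.∣ c ∣)
  A∣T' : Z.∣ A ∣ ND.∣ Z.∣ T ∣
  A∣T' = ZS.∣⇒∣ᵤ A∣T
  -- gcd(A, c) divides T and c, hence B, hence gcd(B, c)
  d∣T : + d ZS.∣ T
  d∣T = ZS.∣ᵤ⇒∣ (ND.∣-trans (NG.gcd[m,n]∣m Z.∣ A ∣ Z.∣ c ∣) A∣T')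
  d∣e : d ND.∣ e
  d∣e = NG.gcd-greatest (ZS.∣⇒∣ᵤ (subst (+ d ZS.∣_) (sym B≡c+T) (ZS.∣m∣n⇒∣m+n d∣c d∣T)))
                        (ZS.∣⇒∣ᵤ d∣c)
  δd∣A : δ N.* d ND.∣ Z.∣ A ∣
  δd∣A = subst (δ N.* d ND.∣_) (reduce-exact A c c≢0) (ND.*-monoˡ-∣ d δ∣A')
  δd∣B : δ N.* d ND.∣ Z.∣ B ∣
  δd∣B = ND.∣-trans (ND.*-monoʳ-∣ δ d∣e)
           (subst (δ N.* e ND.∣_) (reduce-exact B c c≢0) (ND.*-monoˡ-∣ e δ∣B'))
  δd∣c : δ N.* d ND.∣ Z.∣ c ∣
  δd∣c = ZS.∣⇒∣ᵤ (ZS.∣m+n∣n⇒∣m {m = c} {n = T}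
           (subst (+ (δ N.* d) ZS.∣_) B≡c+T (ZS.∣ᵤ⇒∣ δd∣B))
           (ZS.∣ᵤ⇒∣ (ND.∣-trans δd∣A A∣T')))

private-prime-factor : (a : ℕ → ℤ) →
  (∀ m n → 1 ≤ m → 1 ≤ n → m ≢ n → Coprime (a m) (a n)) →
  ∀ n → 1 ≤ n → 2 N.≤ Z.∣ a n ∣ →
  ∃ λ p → Prime p × (+ p) ∣ a n × (∀ m → 1 ≤ m → m ≢ n → ¬ ((+ p) ∣ a m))
private-prime-factor a coprime n 1≤n 2≤aₙ with prime-factor Z.∣ a n ∣ 2≤aₙ
... | p , p-prime , p∣aₙ = p , p-prime , p∣aₙ , λ m 1≤m m≢n p∣aₘ →
  NPr.¬prime[1] (subst Prime (coprime n m 1≤n 1≤m (λ n≡m → m≢n (sym n≡m)) (p∣aₙ , p∣aₘ)) p-prime)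

norm₁ : Poly → ℕ
norm₁ []       = 0
norm₁ (c ∷ cs) = Z.∣ c ∣ N.+ norm₁ cs

-- A nonzero root y of a nonzero polynomial satisfies |y| ≤ ‖p‖₁: after
-- removing the factors y of the zero low-order coefficients, y divides the
-- lowest nonzero coefficient.
root-bound : (p : Poly) (y : ℤ) → (∃ λ j → coeff p j ≢ + 0) → y ≢ + 0 →
  eval p y ≡ + 0 → Z.∣ y ∣ N.≤ norm₁ p
root-bound [] y (j , nonzero) _ _ = ⊥-elim (nonzero refl)
root-bound (c ∷ cs) y (j , nonzero) y≢0 root with c Z.≟ + 0
... | no c≢0 = NP.≤-trans (ND.∣⇒≤ ⦃ N.≢-nonZero (λ eq → c≢0 (ZP.∣i∣≡0⇒i≡0 eq)) ⦄ y∣c) (NP.m≤m+n _ _)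
  where
  y∣c : Z.∣ y ∣ ND.∣ Z.∣ c ∣
  y∣c = ZS.∣⇒∣ᵤ (ZS.∣m+n∣n⇒∣m {y} {c} {y Z.* eval cs y}
          (subst (y ZS.∣_) (sym root) (ZS.∣ᵤ⇒∣ (ND._∣0 _)))
          (ZS.∣m⇒∣m*n (eval cs y) ZS.∣-refl))
... | yes refl with ZP.i*j≡0⇒i≡0∨j≡0 y (trans (sym (ZP.+-identityˡ (y Z.* eval cs y))) root) | j
...   | inj₁ y≡0   | _      = ⊥-elim (y≢0 y≡0)
...   | inj₂ root′ | zero   = ⊥-elim (nonzero refl)
...   | inj₂ root′ | suc j′ = root-bound cs y (j′ , nonzero) y≢0 root′

-- A nonconstant polynomial c + y h(y) exceeds |c| at every y with
-- |y| > 2|c| + ‖h‖₁: otherwise either h(y) = 0 and |y| ≤ ‖h‖₁, or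
-- |y| ≤ |y h(y)| ≤ |g(y)| + |c| ≤ 2|c|.
value-exceeds-constant : ∀ c h y → (∃ λ j → coeff h j ≢ + 0) →
  Z.∣ c ∣ N.+ Z.∣ c ∣ N.+ norm₁ h N.< Z.∣ y ∣ → Z.∣ c ∣ N.< Z.∣ eval (c ∷ h) y ∣
value-exceeds-constant c h y h≢0 large with Z.∣ eval (c ∷ h) y ∣ N.≤? Z.∣ c ∣
... | no  small = NP.≰⇒> small
... | yes small = ⊥-elim (NP.<⇒≱ large bounded)
  where
  y≢0 : y ≢ + 0
  y≢0 refl = NP.<⇒≱ large N.z≤n
  bounded : Z.∣ y ∣ N.≤ Z.∣ c ∣ N.+ Z.∣ c ∣ N.+ norm₁ h
  bounded with eval h y Z.≟ + 0
  ... | yes root = NP.≤-trans (root-bound h y h≢0 y≢0 root) (NP.m≤n+m _ _)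
  ... | no  h[y]≢0 = NP.≤-trans y≤yh (NP.≤-trans yh≤2c (NP.m≤m+n _ _))
    where
    y≤yh : Z.∣ y ∣ N.≤ Z.∣ y Z.* eval h y ∣
    y≤yh = subst (Z.∣ y ∣ N.≤_) (sym (ZP.abs-* y (eval h y)))
             (NP.m≤m*n _ _ ⦃ N.≢-nonZero (λ eq → h[y]≢0 (ZP.∣i∣≡0⇒i≡0 eq)) ⦄)
    yh≤2c : Z.∣ y Z.* eval h y ∣ N.≤ Z.∣ c ∣ N.+ Z.∣ c ∣
    yh≤2c = NP.≤-trans (summand-bound c (y Z.* eval h y)) (NP.+-monoˡ-≤ Z.∣ c ∣ small)

module Orbit (f : ℤ → ℤ) (divides-image : ∀ y → y ZS.∣ f y) (x₀ : ℤ)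
             (wandering : ∀ m n → iter f m x₀ ≡ iter f n x₀ → m ≡ n) where

  x : ℕ → ℤ
  x n = iter f n x₀

  divides-later : ∀ {m n} → m N.≤ n → x m ZS.∣ x n
  divides-later m≤n = go (NP.≤⇒≤′ m≤n)
    where
    go : ∀ {m n} → m N.≤′ n → x m ZS.∣ x n
    go N.≤′-refl          = ZS.∣-refl
    go (N.≤′-step m≤′n) = ZS.∣-trans (go m≤′n) (divides-image _)

  -- 0 is a fixed point of f (0 ∣ f(0)), so a wandering orbit avoids it.
  nonzero : ∀ n → x n ≢ + 0
  nonzero n xₙ≡0 = NP.1+n≢n (sym (wandering n (suc n) (trans xₙ≡0 (sym xₙ₊₁≡0))))
    where
    xₙ₊₁≡0 : x (suc n) ≡ + 0
    xₙ₊₁≡0 = ZS.0∣⇒≡0 (subst (ZS._∣ x (suc n)) xₙ≡0 (divides-image (x n)))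

  -- |x_n| is nondecreasing, since x_m ∣ x_n ≠ 0.
  abs-mono : ∀ {m n} → m N.≤ n → Z.∣ x m ∣ N.≤ Z.∣ x n ∣
  abs-mono {n = n} m≤n =
    ND.∣⇒≤ ⦃ N.≢-nonZero (λ eq → nonzero n (ZP.∣i∣≡0⇒i≡0 eq)) ⦄ (ZS.∣⇒∣ᵤ (divides-later m≤n))

  -- |x_n| < |x_{n+2}|: otherwise x_n, x_{n+1}, x_{n+2} share an absolute value,
  -- so x_{n+1} = −x_n and x_{n+2} = −x_{n+1} = x_n, contradicting wandering.
  abs-grows : ∀ n → Z.∣ x n ∣ N.< Z.∣ x (2 N.+ n) ∣
  abs-grows n = NP.≰⇒> no-return
    where
    no-return : ¬ (Z.∣ x (2 N.+ n) ∣ N.≤ Z.∣ x n ∣)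
    no-return back = NP.m+1+n≢n 1 (wandering (2 N.+ n) n x₂≡x₀)
      where
      step₀ : Z.∣ x n ∣ N.≤ Z.∣ x (suc n) ∣
      step₀ = abs-mono (NP.n≤1+n n)
      step₁ : Z.∣ x (suc n) ∣ N.≤ Z.∣ x (2 N.+ n) ∣
      step₁ = abs-mono (NP.n≤1+n (suc n))
      x₁≡-x₀ : x (suc n) ≡ Z.- x n
      x₁≡-x₀ = sameAbs⇒neg _ _ (NP.≤-antisym (NP.≤-trans step₁ back) step₀)
                 (λ eq → NP.1+n≢n (wandering (suc n) n eq))
      x₂≡-x₁ : x (2 N.+ n) ≡ Z.- x (suc n)
      x₂≡-x₁ = sameAbs⇒neg _ _ (NP.≤-antisym (NP.≤-trans back step₀) step₁)
                 (λ eq → NP.1+n≢n (wandering (2 N.+ n) (suc n) eq))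
      x₂≡x₀ : x (2 N.+ n) ≡ x n
      x₂≡x₀ = trans x₂≡-x₁ (trans (cong Z.-_ x₁≡-x₀) (ZP.neg-involutive (x n)))

  -- |x_n| exceeds any bound B once n ≥ 2B, since |x_{2j}| > j.
  abs-unbounded : ∀ B n → B N.+ B N.≤ n → B N.< Z.∣ x n ∣
  abs-unbounded B n 2B≤n = NP.<-≤-trans (doubling B) (abs-mono 2B≤n)
    where
    doubling : ∀ j → j N.< Z.∣ x (j N.+ j) ∣
    doubling zero    = N.>-nonZero⁻¹ _ ⦃ N.≢-nonZero (λ eq → nonzero 0 (ZP.∣i∣≡0⇒i≡0 eq)) ⦄
    doubling (suc j) = subst (λ k → suc j N.< Z.∣ x (suc k) ∣) (sym (NP.+-suc j j))
                         (NP.<-≤-trans (N.s≤s (doubling j)) (abs-grows (j N.+ j)))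

divides-fmap : ∀ r g y → y ZS.∣ fmap (suc r) g y
divides-fmap r g y = ZS.∣m⇒∣m*n (eval g y) (ZS.∣m⇒∣m*n (y Z.^ r) ZS.∣-refl)

value-divides-fmap : ∀ r g y → eval g y ZS.∣ fmap r g y
value-divides-fmap r g y = ZS.∣n⇒∣m*n (y Z.^ r) ZS.∣-refl

module ReducedValues (r : ℕ) (c : ℤ) (h : Poly) (x₀ : ℤ)
  (wandering : ∀ m n → iter (fmap (suc r) (c ∷ h)) m x₀ ≡ iter (fmap (suc r) (c ∷ h)) n x₀ → m ≡ n)
  (g0≢0 : eval (c ∷ h) (+ 0) ≢ + 0) (h≢0 : ∃ λ j → coeff h j ≢ + 0) where

  open Orbit (fmap (suc r) (c ∷ h)) (divides-fmap r (c ∷ h)) x₀ wandering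

  C : ℤ
  C = eval (c ∷ h) (+ 0)

  a : ℕ → ℤ
  a = aSeq (suc r) (c ∷ h) x₀

  C≡c : C ≡ c
  C≡c = ZP.+-identityʳ c

  value-split : ∀ n → eval (c ∷ h) (x n) ≡ C Z.+ x n Z.* eval h (x n)
  value-split n = cong (Z._+ x n Z.* eval h (x n)) (sym C≡c)

  earlier-divides : ∀ {m n} → m N.< n → eval (c ∷ h) (x m) ZS.∣ x n Z.* eval h (x n)
  earlier-divides {m} {n} m<n = ZS.∣m⇒∣m*n (eval h (x n))
    (ZS.∣-trans (value-divides-fmap (suc r) (c ∷ h) (x m)) (divides-later m<n))

  coprime-ordered : ∀ m n → m N.< n → Coprime (a (suc m)) (a (suc n))
  coprime-ordered m n m<n = reduce-coprime g0≢0 (earlier-divides m<n) (value-split n)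

  pairwise-coprime : ∀ m n → 1 ≤ m → 1 ≤ n → m ≢ n → Coprime (a m) (a n)
  pairwise-coprime (suc m) (suc n) _ _ m≢n with NP.<-cmp m n
  ... | tri< m<n _ _ = coprime-ordered m n m<n
  ... | tri≈ _ m≡n _ = ⊥-elim (m≢n (cong suc m≡n))
  ... | tri> _ _ n<m = ZC.sym {a (suc n)} {a (suc m)} (coprime-ordered n m n<m)

  -- Beyond this bound on |x_n|, the value g(x_n) exceeds |C|.
  bound : ℕ
  bound = Z.∣ c ∣ N.+ Z.∣ c ∣ N.+ norm₁ h

  eventually-large : ∀ k → bound N.+ bound N.≤ k → 2 N.≤ Z.∣ a (suc k) ∣
  eventually-large k 2B≤k = reduce-large (eval (c ∷ h) (x k)) C g0≢0
    (subst (λ z → Z.∣ z ∣ N.< Z.∣ eval (c ∷ h) (x k) ∣) (sym C≡c)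
      (value-exceeds-constant c h (x k) h≢0 (abs-unbounded bound k 2B≤k)))

  threshold : ℕ
  threshold = suc (bound N.+ bound)

  eventually-private : ∀ n → n ≥ threshold → 1 ≤ n →
    ∃ λ p → Prime p × (+ p) ∣ a n × (∀ m → 1 ≤ m → m ≢ n → ¬ ((+ p) ∣ a m))
  eventually-private (suc k) (N.s≤s 2B≤k) 1≤n =
    private-prime-factor a pairwise-coprime (suc k) 1≤n (eventually-large k 2B≤k)

theorem5 : (r : ℕ) → 1 ≤ r → (g : Poly) →
    (∃ λ i → 1 ≤ i × coeff g i ≢ + 0) →
    eval g (+ 0) ≢ + 0 →
    (x₀ : ℤ) →
    (∀ m n → iter (fmap r g) m x₀ ≡ iter (fmap r g) n x₀ → m ≡ n) →
    (∀ m n → 1 ≤ m → 1 ≤ n → m ≢ n → Coprime (aSeq r g x₀ m) (aSeq r g x₀ n))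
    × (∃ λ N → ∀ n → n ≥ N → 1 ≤ n →
    ∃ λ p → Prime p × (+ p) ∣ aSeq r g x₀ n ×
    (∀ m → 1 ≤ m → m ≢ n → ¬ ((+ p) ∣ aSeq r g x₀ m)))
theorem5 r _ [] _ g0≢0 _ _ = ⊥-elim (g0≢0 refl)
theorem5 (suc r) _ (c ∷ h) (zero , () , _) _ _ _
theorem5 (suc r) _ (c ∷ h) (suc i , _ , hᵢ≢0) g0≢0 x₀ wandering =
  pairwise-coprime , threshold , eventually-private
  where open ReducedValues r c h x₀ wandering g0≢0 (i , hᵢ≢0)
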